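{- Let $r,s\ge1$. Then, as a polynomial identity in $q$, $$\sum_C(q-1)^{|S(C)|-l(C)}(-1)^{|S(C)|}=q^{\min(r,s)},$$ where the sum runs over all cells $C$ of $\mathcal{T}_{rs}$, including the empty one.
   Context: A cell of $\mathcal{T}_{rs}$ is a (possibly empty) sequence $C=((i_1,j_1),\ldots,(i_l,j_l))$ of distinct pairs in $\{1,\ldots,r\}\times\{1,\ldots,s\}$ with $i_1\le\cdots\le i_l$ and $j_1\le\cdots\le j_l$; $l(C)=l$ is its length and $|S(C)|=|\{i_1,\ldots,i_l\}|+|\{j_1,\ldots,j_l\}|$ is the size of its support. -}

module Defs where

open import Data.Nat using (ℕ; zero; suc; _*_; _∸_; _≤_)
open import Data.Fin using (Fin; toℕ)
open import Data.Fin.Properties using () renaming (_≟_ to _≟ᶠ_)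
open import Data.Nat.Properties using (_≤?_)
open import Data.Product using (_×_; _,_; proj₁; proj₂)
open import Data.Product.Properties using (≡-dec)
open import Data.List using (List; []; _∷_; map; concatMap; concat; length; filter; deduplicate; upTo; allFin; cartesianProduct)
open import Data.List.Relation.Unary.Linked using (Linked)
open import Data.List.Relation.Unary.Linked.Properties using ()
import Data.List.Relation.Unary.Linked as Linked
open import Data.List.Relation.Unary.Unique.Propositional using (Unique)
open import Data.List.Relation.Unary.Unique.DecPropositional using (unique?)
open import Relation.Nullary using (Dec)
open import Relation.Nullary.Decidable using (_×-dec_)
open import Relation.Binary.PropositionalEquality using (_≡_)
open import Data.Integer as ℤ using (ℤ; +_; -_; _-_; _^_)

-- A position (i , j) ∈ {1..r} × {1..s}, 0-indexed via Fin.
Pos : ℕ → ℕ → Set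
Pos r s = Fin r × Fin s

_≟ₚ_ : ∀ {r s} (x y : Pos r s) → Dec (x ≡ y)
_≟ₚ_ = ≡-dec _≟ᶠ_ _≟ᶠ_

_≼_ : ∀ {r s} → Pos r s → Pos r s → Set
(i , j) ≼ (i' , j') = (toℕ i ≤ toℕ i') × (toℕ j ≤ toℕ j')

_≼?_ : ∀ {r s} (x y : Pos r s) → Dec (x ≼ y)
(i , j) ≼? (i' , j') = (toℕ i ≤? toℕ i') ×-dec (toℕ j ≤? toℕ j')

IsCell : ∀ {r s} → List (Pos r s) → Set
IsCell C = Unique C × Linked _≼_ C

isCell? : ∀ {r s} (C : List (Pos r s)) → Dec (IsCell C)
isCell? C = unique? _≟ₚ_ C ×-dec Linked.linked? _≼?_ C

listsOfLength : ∀ {A : Set} → ℕ → List A → List (List A)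
listsOfLength zero    xs = [] ∷ []
listsOfLength (suc k) xs = concatMap (λ a → map (a ∷_) (listsOfLength k xs)) xs

listsUpTo : ∀ {A : Set} → ℕ → List A → List (List A)
listsUpTo n xs = concatMap (λ k → listsOfLength k xs) (upTo (suc n))

allPos : ∀ r s → List (Pos r s)
allPos r s = cartesianProduct (allFin r) (allFin s)

-- All cells of T_rs (each exactly once). A cell has distinct entries,
-- hence length ≤ r * s, so it occurs among the lists of length ≤ r * s.
cells : ∀ r s → List (List (Pos r s))
cells r s = filter isCell? (listsUpTo (r * s) (allPos r s))

len : ∀ {r s} → List (Pos r s) → ℕ
len = length

supportSize : ∀ {r s} → List (Pos r s) → ℕ
supportSize C = length (deduplicate _≟ᶠ_ (map proj₁ C))
              Data.Nat.+ length (deduplicate _≟ᶠ_ (map proj₂ C))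

term : ∀ {r s} → ℤ → List (Pos r s) → ℤ
term q C = ((q - + 1) ^ (supportSize C ∸ len C)) ℤ.* ((- + 1) ^ supportSize C)

sumℤ : List ℤ → ℤ
sumℤ [] = + 0
sumℤ (x ∷ xs) = x ℤ.+ sumℤ xs

cellSum : ℕ → ℕ → ℤ → ℤ
cellSum r s q = sumℤ (map (term q) (cells r s))

module Submission where

open import Defs
open import Data.Nat using (ℕ; _≤_; _⊓_)
open import Data.Integer using (ℤ; _^_)
open import Relation.Binary.PropositionalEquality using (_≡_)

open import Data.Bool using (Bool; true; false; if_then_else_; _∧_)
open import Data.Fin as Fin using (Fin; toℕ)
open import Data.Fin.Properties using (toℕ-injective; toℕ<n) renaming (_≟_ to _≟ᶠ_)
open import Data.Integer using (+_; -_; _+_; _*_; _-_)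
open import Data.Integer.Properties using (+-identityʳ; +-identityˡ; +-assoc; +-comm; *-zeroˡ; *-zeroʳ; *-distribˡ-+; +-commutativeSemigroup)
open import Algebra.Properties.CommutativeSemigroup +-commutativeSemigroup using (interchange)
open import Data.Integer.Tactic.RingSolver using (solve-∀)
open import Data.List using (List; []; _∷_; length; map; concatMap; filter; deduplicate; applyUpTo; upTo; allFin; tabulate; cartesianProduct; _++_)
open import Data.List.Properties using (map-∘; filter-reject; filter-idem; filter-all)
open import Data.List.Relation.Unary.All as All using (All; []; _∷_)
open import Data.List.Relation.Unary.All.Properties using (filter⁺) renaming (map⁺ to All-map⁺)
open import Data.List.Relation.Unary.AllPairs using (_∷_)
open import Data.List.Relation.Unary.Linked using (Linked; [-]; _∷_)
open import Data.List.Relation.Unary.Linked.Properties using (Linked⇒All)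
open import Data.Nat as ℕ using (zero; suc; _<_; z≤n; s≤s; _∸_)
open import Data.Nat.Properties as ℕ using (_≟_; _≤?_; _<?_)
import Algebra.Properties.CommutativeSemigroup ℕ.+-commutativeSemigroup as ℕ+
open import Data.Product using (_×_; _,_; proj₁; proj₂)
open import Data.Sum using (_⊎_; inj₁; inj₂)
open import Function using (_∘_; id)
open import Relation.Binary using (tri<; tri≈; tri>)
open import Relation.Binary.PropositionalEquality using (_≢_; refl; sym; trans; cong; cong₂; subst; module ≡-Reasoning)
open import Relation.Nullary using (Dec; yes; no; ¬_; ¬?; does; contradiction)
open import Relation.Nullary.Decidable using (_×-dec_; dec-true; dec-false; does-⇔)
open import Function.Bundles using (mk⇔)

-- Read a cell from its first entry. Prepending a position p to a cell starting at p′ multiplies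
-- its summand by a factor w(p, p′) depending only on p and p′: q − 1 if both coordinates grow
-- (two new support elements for one new entry), −1 if exactly one grows, and 0 if the result is
-- not a cell. Hence the total weight F(p) of the cells starting at p obeys
-- F(p) = (q − 1) + Σ_{p′} w(p, p′) F(p′), which determines F by induction on the distance of p to
-- the far corner. Measuring positions from that corner, (m, n) = (r − 1 − i, s − 1 − j), the
-- solution is F = (q − 1) q^m on the diagonal m = n and 0 elsewhere. Summing over p and adding 1
-- for the empty cell gives 1 + (q − 1)(1 + q + ⋯ + q^(min(r,s) − 1)) = q^min(r,s).

sumBelow : ℕ → (ℕ → ℤ) → ℤ
sumBelow zero    f = + 0
sumBelow (suc n) f = f 0 + sumBelow n (f ∘ suc)

infix 7 sumBelow
syntax sumBelow n (λ k → e) = ∑[ k < n ] e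

sumBelow-cong : ∀ n {f g : ℕ → ℤ} → (∀ k → k < n → f k ≡ g k) → sumBelow n f ≡ sumBelow n g
sumBelow-cong zero    f≗g = refl
sumBelow-cong (suc n) f≗g = cong₂ _+_ (f≗g 0 (s≤s z≤n)) (sumBelow-cong n (λ k k<n → f≗g (suc k) (s≤s k<n)))

sumBelow-suc : ∀ n f → sumBelow (suc n) f ≡ sumBelow n f + f n
sumBelow-suc zero    f = trans (+-identityʳ (f 0)) (sym (+-identityˡ (f 0)))
sumBelow-suc (suc n) f = trans (cong (_+_ (f 0)) (sumBelow-suc n (f ∘ suc))) (sym (+-assoc (f 0) _ _))

sumBelow-+ : ∀ n f g → ∑[ k < n ] (f k + g k) ≡ sumBelow n f + sumBelow n g
sumBelow-+ zero    f g = refl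
sumBelow-+ (suc n) f g = trans (cong (_+_ (f 0 + g 0)) (sumBelow-+ n (f ∘ suc) (g ∘ suc)))
                               (interchange (f 0) (g 0) _ _)

sumBelow-*ˡ : ∀ n c f → ∑[ k < n ] (c * f k) ≡ c * sumBelow n f
sumBelow-*ˡ zero    c f = sym (*-zeroʳ c)
sumBelow-*ˡ (suc n) c f = trans (cong (_+_ (c * f 0)) (sumBelow-*ˡ n c (f ∘ suc))) (sym (*-distribˡ-+ c (f 0) _))

sumBelow-zero : ∀ n → ∑[ k < n ] (+ 0) ≡ + 0
sumBelow-zero zero    = refl
sumBelow-zero (suc n) = trans (+-identityˡ _) (sumBelow-zero n)

sumBelow-reverse : ∀ n f → ∑[ k < n ] f (n ∸ suc k) ≡ sumBelow n f
sumBelow-reverse zero    f = refl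
sumBelow-reverse (suc n) f = begin
  f n + ∑[ k < n ] f (n ∸ suc k) ≡⟨ cong (_+_ (f n)) (sumBelow-reverse n f) ⟩
  f n + sumBelow n f             ≡⟨ +-comm (f n) _ ⟩
  sumBelow n f + f n             ≡⟨ sym (sumBelow-suc n f) ⟩
  sumBelow (suc n) f             ∎
  where open ≡-Reasoning

sumBelow-vanishing : ∀ {m n} f → m ≤ n → (∀ k → m ≤ k → f k ≡ + 0) → sumBelow n f ≡ sumBelow m f
sumBelow-vanishing {m} {n} f m≤n tail with ℕ.m≤n⇒m<n∨m≡n m≤n
... | inj₂ refl = refl
sumBelow-vanishing {m} {suc n} f m≤n tail | inj₁ m<1+n = begin
  sumBelow (suc n) f  ≡⟨ sumBelow-suc n f ⟩
  sumBelow n f + f n  ≡⟨ cong₂ _+_ (sumBelow-vanishing f (ℕ.≤-pred m<1+n) tail) (tail n (ℕ.≤-pred m<1+n)) ⟩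
  sumBelow m f + + 0  ≡⟨ +-identityʳ _ ⟩
  sumBelow m f        ∎
  where open ≡-Reasoning

sumBelow-reverse₂ : ∀ m n (f : ℕ → ℕ → ℤ) →
  ∑[ a < m ] ∑[ b < n ] f (m ∸ suc a) (n ∸ suc b) ≡ ∑[ i < m ] ∑[ j < n ] f i j
sumBelow-reverse₂ m n f =
  trans (sumBelow-cong m (λ a _ → sumBelow-reverse n (f (m ∸ suc a)))) (sumBelow-reverse m (λ i → sumBelow n (f i)))

sumOver : ∀ {A : Set} → (A → ℤ) → List A → ℤ
sumOver f xs = sumℤ (map f xs)

module _ {A : Set} where

  sumOver-cong : ∀ {f g : A → ℤ} xs → (∀ x → f x ≡ g x) → sumOver f xs ≡ sumOver g xs
  sumOver-cong []       f≗g = refl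
  sumOver-cong (x ∷ xs) f≗g = cong₂ _+_ (f≗g x) (sumOver-cong xs f≗g)

  sumOver-*ˡ : ∀ c (f : A → ℤ) xs → sumOver (λ x → c * f x) xs ≡ c * sumOver f xs
  sumOver-*ˡ c f []       = sym (*-zeroʳ c)
  sumOver-*ˡ c f (x ∷ xs) = trans (cong (_+_ (c * f x)) (sumOver-*ˡ c f xs)) (sym (*-distribˡ-+ c (f x) _))

  sumOver-++ : ∀ (f : A → ℤ) xs ys → sumOver f (xs ++ ys) ≡ sumOver f xs + sumOver f ys
  sumOver-++ f []       ys = sym (+-identityˡ _)
  sumOver-++ f (x ∷ xs) ys = trans (cong (_+_ (f x)) (sumOver-++ f xs ys)) (sym (+-assoc (f x) _ _))

  sumOver-map : ∀ {B : Set} (f : A → ℤ) (g : B → A) ys → sumOver f (map g ys) ≡ sumOver (f ∘ g) ys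
  sumOver-map f g ys = cong sumℤ (sym (map-∘ ys))

  sumOver-concatMap : ∀ {B : Set} (f : A → ℤ) (g : B → List A) ys →
    sumOver f (concatMap g ys) ≡ sumOver (λ y → sumOver f (g y)) ys
  sumOver-concatMap f g []       = refl
  sumOver-concatMap f g (y ∷ ys) =
    trans (sumOver-++ f (g y) (concatMap g ys)) (cong (_+_ (sumOver f (g y))) (sumOver-concatMap f g ys))

  sumOver-filter : ∀ {P : A → Set} (P? : ∀ x → Dec (P x)) (f : A → ℤ) xs →
    sumOver f (filter P? xs) ≡ sumOver (λ x → if does (P? x) then f x else + 0) xs
  sumOver-filter P? f []       = refl
  sumOver-filter P? f (x ∷ xs) with P? x
  ... | yes _ = cong (_+_ (f x)) (sumOver-filter P? f xs)
  ... | no  _ = trans (sumOver-filter P? f xs) (sym (+-identityˡ _))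

  sumBelow-sumOver-comm : ∀ n (f : ℕ → A → ℤ) xs →
    ∑[ k < n ] sumOver (f k) xs ≡ sumOver (λ x → ∑[ k < n ] f k x) xs
  sumBelow-sumOver-comm n f []       = sumBelow-zero n
  sumBelow-sumOver-comm n f (x ∷ xs) =
    trans (sumBelow-+ n (λ k → f k x) (λ k → sumOver (f k) xs))
          (cong (_+_ (sumBelow n (λ k → f k x))) (sumBelow-sumOver-comm n f xs))

sumOver-applyUpTo : ∀ (f : ℕ → ℤ) g n → sumOver f (applyUpTo g n) ≡ sumBelow n (f ∘ g)
sumOver-applyUpTo f g zero    = refl
sumOver-applyUpTo f g (suc n) = cong (_+_ (f (g 0))) (sumOver-applyUpTo f (g ∘ suc) n)

sumOver-tabulate : ∀ {A : Set} n (h : Fin n → A) (f : A → ℤ) (g : ℕ → ℤ) →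
  (∀ i → f (h i) ≡ g (toℕ i)) → sumOver f (tabulate h) ≡ sumBelow n g
sumOver-tabulate zero    h f g f∘h≗g = refl
sumOver-tabulate (suc n) h f g f∘h≗g =
  cong₂ _+_ (f∘h≗g Fin.zero) (sumOver-tabulate n (h ∘ Fin.suc) f (g ∘ suc) (f∘h≗g ∘ Fin.suc))

sumOver-cartesianProduct : ∀ {A B : Set} (f : A × B → ℤ) xs ys →
  sumOver f (cartesianProduct xs ys) ≡ sumOver (λ x → sumOver (λ y → f (x , y)) ys) xs
sumOver-cartesianProduct f []       ys = refl
sumOver-cartesianProduct f (x ∷ xs) ys =
  trans (sumOver-++ f (map (x ,_) ys) _)
        (cong₂ _+_ (sumOver-map f (x ,_) ys) (sumOver-cartesianProduct f xs ys))

sumOver-allPos : ∀ r s (f : Pos r s → ℤ) (g : ℕ → ℕ → ℤ) →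
  (∀ i j → f (i , j) ≡ g (toℕ i) (toℕ j)) → sumOver f (allPos r s) ≡ ∑[ i < r ] sumBelow s (g i)
sumOver-allPos r s f g f≗g =
  trans (sumOver-cartesianProduct f (allFin r) (allFin s))
        (sumOver-tabulate r id _ _ (λ i → sumOver-tabulate s id _ _ (f≗g i)))

ifᵈ-yes : ∀ {A B : Set} (a? : Dec A) {x y : B} → A → (if does a? then x else y) ≡ x
ifᵈ-yes a? {x} {y} a = cong (λ b → if b then x else y) (dec-true a? a)

ifᵈ-no : ∀ {A B : Set} (a? : Dec A) {x y : B} → ¬ A → (if does a? then x else y) ≡ y
ifᵈ-no a? {x} {y} ¬a = cong (λ b → if b then x else y) (dec-false a? ¬a)

fresh : Bool → ℕ
fresh true  = 0
fresh false = 1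

fresh-cases : ∀ {A : Set} (a? : Dec A) {m n} → (A → m ≡ n) → (¬ A → m ≡ suc n) → m ≡ fresh (does a?) ℕ.+ n
fresh-cases (yes a) m≡n _     = m≡n a
fresh-cases (no ¬a) _   m≡1+n = m≡1+n ¬a

1≤fresh+fresh : ∀ b c → b ∧ c ≡ false → 1 ≤ fresh b ℕ.+ fresh c
1≤fresh+fresh true  false _ = ℕ.≤-refl
1≤fresh+fresh false _     _ = s≤s z≤n

-- The arguments record whether the row, resp. the column, is repeated.
stepWeight : ℤ → Bool → Bool → ℤ
stepWeight q true  true  = + 0
stepWeight q true  false = - + 1
stepWeight q false true  = - + 1
stepWeight q false false = q - + 1

termOf : ℤ → ℕ → ℕ → ℤ
termOf q S l = ((q - + 1) ^ (S ∸ l)) * ((- + 1) ^ S)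

termOf-suc : ∀ q S l → termOf q (suc S) (suc l) ≡ - + 1 * termOf q S l
termOf-suc q S l = oneNew ((q - + 1) ^ (S ∸ l)) ((- + 1) ^ S)
  where
  oneNew : ∀ x y → x * (- + 1 * y) ≡ - + 1 * (x * y)
  oneNew = solve-∀

termOf-step : ∀ q b c {S l} → b ∧ c ≡ false → l ≤ S →
  termOf q (fresh b ℕ.+ fresh c ℕ.+ S) (suc l) ≡ stepWeight q b c * termOf q S l
termOf-step q true  false {S} {l} _ _ = termOf-suc q S l
termOf-step q false true  {S} {l} _ _ = termOf-suc q S l
termOf-step q false false {S} {l} _ l≤S =
  trans (cong (λ e → (q - + 1) ^ e * (- + 1) ^ suc (suc S)) (ℕ.+-∸-assoc 1 l≤S))
        (twoNew (q - + 1) ((q - + 1) ^ (S ∸ l)) ((- + 1) ^ S))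
  where
  twoNew : ∀ a x y → (a * x) * (- + 1 * (- + 1 * y)) ≡ a * (x * y)
  twoNew = solve-∀

distinct : ∀ {n} → List (Fin n) → ℕ
distinct xs = length (deduplicate _≟ᶠ_ xs)

distinct-dup : ∀ {n} (x : Fin n) xs → distinct (x ∷ x ∷ xs) ≡ distinct (x ∷ xs)
distinct-dup x xs = cong (suc ∘ length)
  (trans (filter-reject (¬? ∘ (x ≟ᶠ_)) (λ ¬x≡x → ¬x≡x refl))
         (filter-idem (¬? ∘ (x ≟ᶠ_)) (deduplicate _≟ᶠ_ xs)))

All-deduplicate : ∀ {n} {P : Fin n → Set} {xs} → All P xs → All P (deduplicate _≟ᶠ_ xs)
All-deduplicate []                = []
All-deduplicate {xs = x ∷ _} (px ∷ pxs) = px ∷ filter⁺ (¬? ∘ (x ≟ᶠ_)) (All-deduplicate pxs)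

distinct-new : ∀ {n} (x : Fin n) {xs} → All (x ≢_) xs → distinct (x ∷ xs) ≡ suc (distinct xs)
distinct-new x x∉xs = cong (suc ∘ length) (filter-all (¬? ∘ (x ≟ᶠ_)) (All-deduplicate x∉xs))

distinct-sorted-∷ : ∀ {n} (x y : Fin n) xs → toℕ x ≤ toℕ y → All (λ z → toℕ y ≤ toℕ z) xs →
  distinct (x ∷ y ∷ xs) ≡ fresh (does (toℕ x ≟ toℕ y)) ℕ.+ distinct (y ∷ xs)
distinct-sorted-∷ x y xs x≤y y≤xs = fresh-cases (toℕ x ≟ toℕ y) repeated new
  where
  repeated : toℕ x ≡ toℕ y → distinct (x ∷ y ∷ xs) ≡ distinct (y ∷ xs)
  repeated x≡y rewrite toℕ-injective x≡y = distinct-dup y xs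
  new : toℕ x ≢ toℕ y → distinct (x ∷ y ∷ xs) ≡ suc (distinct (y ∷ xs))
  new x≢y = distinct-new x (x≢y ∘ cong toℕ ∷ All.map x≢z y≤xs)
    where
    x≢z : ∀ {z} → toℕ y ≤ toℕ z → x ≢ z
    x≢z y≤z refl = x≢y (ℕ.≤-antisym x≤y y≤z)

weightℕ : ℤ → ℕ → ℕ → ℕ → ℕ → ℤ
weightℕ q i j i' j' =
  if does ((i ≤? i') ×-dec (j ≤? j')) then stepWeight q (does (i ≟ i')) (does (j ≟ j')) else + 0

weightℕ-≤ : ∀ q {i j i' j'} → i ≤ i' × j ≤ j' → weightℕ q i j i' j' ≡ stepWeight q (does (i ≟ i')) (does (j ≟ j'))
weightℕ-≤ q {i} {j} {i'} {j'} = ifᵈ-yes ((i ≤? i') ×-dec (j ≤? j'))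

weightℕ-≰ : ∀ q {i j i' j'} → ¬ (i ≤ i' × j ≤ j') → weightℕ q i j i' j' ≡ + 0
weightℕ-≰ q {i} {j} {i'} {j'} = ifᵈ-no ((i ≤? i') ×-dec (j ≤? j'))

module _ {r s : ℕ} where

  ≼-trans : {x y z : Pos r s} → x ≼ y → y ≼ z → x ≼ z
  ≼-trans (i≤i' , j≤j') (i'≤i'' , j'≤j'') = ℕ.≤-trans i≤i' i'≤i'' , ℕ.≤-trans j≤j' j'≤j''

  ≼-antisym : {x y : Pos r s} → x ≼ y → y ≼ x → x ≡ y
  ≼-antisym (i≤i' , j≤j') (i'≤i , j'≤j) =
    cong₂ _,_ (toℕ-injective (ℕ.≤-antisym i≤i' i'≤i)) (toℕ-injective (ℕ.≤-antisym j≤j' j'≤j))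

  Linked⇒All≼ : ∀ {x : Pos r s} {xs} → Linked _≼_ (x ∷ xs) → All (x ≼_) xs
  Linked⇒All≼ [-]               = []
  Linked⇒All≼ (x≼y ∷ y∷xs-sorted) = Linked⇒All ≼-trans x≼y y∷xs-sorted

  isCell-∷∷⁻ : ∀ {p p' : Pos r s} {L} → IsCell (p ∷ p' ∷ L) → p ≼ p' × p ≢ p' × IsCell (p' ∷ L)
  isCell-∷∷⁻ ((p≢p' ∷ _) ∷ unique , p≼p' ∷ sorted) = p≼p' , p≢p' , (unique , sorted)

  isCell-∷∷⁺ : ∀ {p p' : Pos r s} {L} → p ≼ p' → p ≢ p' → IsCell (p' ∷ L) → IsCell (p ∷ p' ∷ L)
  isCell-∷∷⁺ {p} {p'} p≼p' p≢p' (unique , sorted) =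
    (p≢p' ∷ All.map p≢ (Linked⇒All≼ sorted)) ∷ unique , p≼p' ∷ sorted
    where
    p≢ : ∀ {y} → p' ≼ y → p ≢ y
    p≢ p'≼y refl = p≢p' (≼-antisym p≼p' p'≼y)

  supportSize-∷∷ : ∀ {i i' : Fin r} {j j' : Fin s} {L} → (i , j) ≼ (i' , j') → Linked _≼_ ((i' , j') ∷ L) →
    supportSize ((i , j) ∷ (i' , j') ∷ L)
      ≡ fresh (does (toℕ i ≟ toℕ i')) ℕ.+ fresh (does (toℕ j ≟ toℕ j')) ℕ.+ supportSize ((i' , j') ∷ L)
  supportSize-∷∷ {i} {i'} {j} {j'} {L} (i≤i' , j≤j') sorted =
    trans (cong₂ ℕ._+_ (distinct-sorted-∷ i i' (map proj₁ L) i≤i' (All-map⁺ (All.map proj₁ p'≼L)))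
                       (distinct-sorted-∷ j j' (map proj₂ L) j≤j' (All-map⁺ (All.map proj₂ p'≼L))))
          (ℕ+.interchange (fresh (does (toℕ i ≟ toℕ i'))) (distinct (i' ∷ map proj₁ L))
                          (fresh (does (toℕ j ≟ toℕ j'))) (distinct (j' ∷ map proj₂ L)))
    where p'≼L = Linked⇒All≼ sorted

  ≢⇒notBothRepeated : ∀ {i i' : Fin r} {j j' : Fin s} → (i , j) ≢ (i' , j') →
    does (toℕ i ≟ toℕ i') ∧ does (toℕ j ≟ toℕ j') ≡ false
  ≢⇒notBothRepeated {i} {i'} {j} {j'} p≢p' = dec-false ((toℕ i ≟ toℕ i') ×-dec (toℕ j ≟ toℕ j'))
    (λ (i≡i' , j≡j') → p≢p' (cong₂ _,_ (toℕ-injective i≡i') (toℕ-injective j≡j')))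

  length≤supportSize : ∀ {C : List (Pos r s)} → IsCell C → length C ≤ supportSize C
  length≤supportSize {[]}                        _    = z≤n
  length≤supportSize {_ ∷ []}                    _    = s≤s z≤n
  length≤supportSize {(i , j) ∷ p'@(i' , j') ∷ L} cell =
    let p≼p' , p≢p' , cell' = isCell-∷∷⁻ cell
    in  subst (suc (length (p' ∷ L)) ≤_) (sym (supportSize-∷∷ {i} {i'} {j} {j'} p≼p' (proj₂ cell')))
          (ℕ.+-mono-≤ (1≤fresh+fresh (does (toℕ i ≟ toℕ i')) (does (toℕ j ≟ toℕ j'))
                                      (≢⇒notBothRepeated {i} {i'} {j} {j'} p≢p'))
                      (length≤supportSize {p' ∷ L} cell'))

  term-∷∷ : ∀ q {i i' : Fin r} {j j' : Fin s} {L} → (i , j) ≼ (i' , j') → (i , j) ≢ (i' , j') → IsCell ((i' , j') ∷ L) →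
    term q ((i , j) ∷ (i' , j') ∷ L) ≡ stepWeight q (does (toℕ i ≟ toℕ i')) (does (toℕ j ≟ toℕ j')) * term q ((i' , j') ∷ L)
  term-∷∷ q {i} {i'} {j} {j'} {L} p≼p' p≢p' cell' =
    trans (cong (λ S → termOf q S (suc (length ((i' , j') ∷ L)))) (supportSize-∷∷ {i} {i'} {j} {j'} p≼p' (proj₂ cell')))
          (termOf-step q (does (toℕ i ≟ toℕ i')) (does (toℕ j ≟ toℕ j'))
                       (≢⇒notBothRepeated {i} {i'} {j} {j'} p≢p') (length≤supportSize {(i' , j') ∷ L} cell'))

  weight : ℤ → Pos r s → Pos r s → ℤ
  weight q (i , j) (i' , j') = weightℕ q (toℕ i) (toℕ j) (toℕ i') (toℕ j')

  weight-support : ∀ q (p p' : Pos r s) → weight q p p' ≡ + 0 ⊎ (p ≼ p' × p ≢ p')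
  weight-support q (i , j) (i' , j') with (i , j) ≼? (i' , j')
  ... | no  p⋠p' = inj₁ (weightℕ-≰ q p⋠p')
  ... | yes p≼p' with toℕ i ≟ toℕ i' | toℕ j ≟ toℕ j'
  ...   | yes i≡i' | yes j≡j' =
          inj₁ (trans (weightℕ-≤ q p≼p') (cong₂ (stepWeight q) (dec-true (toℕ i ≟ _) i≡i') (dec-true (toℕ j ≟ _) j≡j')))
  ...   | no  i≢i' | _        = inj₂ (p≼p' , i≢i' ∘ cong (toℕ ∘ proj₁))
  ...   | yes _    | no  j≢j' = inj₂ (p≼p' , j≢j' ∘ cong (toℕ ∘ proj₂))

  cellWeight : ℤ → List (Pos r s) → ℤ
  cellWeight q C = if does (isCell? C) then term q C else + 0

  cellWeight-∷∷ : ∀ q (p p' : Pos r s) L → cellWeight q (p ∷ p' ∷ L) ≡ weight q p p' * cellWeight q (p' ∷ L)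
  cellWeight-∷∷ q p@(i , j) p'@(i' , j') L = byCases (isCell? (p ∷ p' ∷ L)) (isCell? (p' ∷ L))
    where
    byCases : (c? : Dec (IsCell (p ∷ p' ∷ L))) (c'? : Dec (IsCell (p' ∷ L))) →
      (if does c? then term q (p ∷ p' ∷ L) else + 0) ≡ weight q p p' * (if does c'? then term q (p' ∷ L) else + 0)
    byCases (yes cell) (yes cell') with isCell-∷∷⁻ cell
    ... | p≼p' , p≢p' , _ = trans (term-∷∷ q p≼p' p≢p' cell') (cong (_* term q (p' ∷ L)) (sym (weightℕ-≤ q p≼p')))
    byCases (yes cell) (no ¬cell') = contradiction (proj₂ (proj₂ (isCell-∷∷⁻ cell))) ¬cell'
    byCases (no ¬cell) (yes cell') with weight-support q p p'
    ... | inj₁ w≡0          = sym (trans (cong (_* term q (p' ∷ L)) w≡0) (*-zeroˡ (term q (p' ∷ L))))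
    ... | inj₂ (p≼p' , p≢p') = contradiction (isCell-∷∷⁺ p≼p' p≢p' cell') ¬cell
    byCases (no _) (no _) = sym (*-zeroʳ (weight q p p'))

geometric-sum : ∀ q n → (q - + 1) * (∑[ k < n ] q ^ k) ≡ q ^ n - + 1
geometric-sum q zero    = *-zeroʳ (q - + 1)
geometric-sum q (suc n) = begin
  (q - + 1) * (∑[ k < suc n ] q ^ k)                 ≡⟨ cong ((q - + 1) *_) (sumBelow-suc n (q ^_)) ⟩
  (q - + 1) * (∑[ k < n ] q ^ k + q ^ n)             ≡⟨ *-distribˡ-+ (q - + 1) _ (q ^ n) ⟩
  (q - + 1) * (∑[ k < n ] q ^ k) + (q - + 1) * q ^ n ≡⟨ cong (_+ (q - + 1) * q ^ n) (geometric-sum q n) ⟩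
  (q ^ n - + 1) + (q - + 1) * q ^ n                   ≡⟨ telescope q (q ^ n) ⟩
  q ^ suc n - + 1                                     ∎
  where
  open ≡-Reasoning
  telescope : ∀ q x → (x - + 1) + (q - + 1) * x ≡ q * x - + 1
  telescope = solve-∀

diagonal : ℤ → ℕ → ℕ → ℤ
diagonal q a b = if does (a ≟ b) then q ^ a else + 0

below : ℤ → ℕ → ℕ → ℤ
below q a n = if does (a <? n) then q ^ a else + 0

diagonal-comm : ∀ q a b → diagonal q a b ≡ diagonal q b a
diagonal-comm q a b with a ≟ b
... | yes refl = refl
... | no  a≢b  = trans (ifᵈ-no (a ≟ b) a≢b) (sym (ifᵈ-no (b ≟ a) (a≢b ∘ sym)))

below-suc : ∀ q a n → below q a (suc n) ≡ below q a n + diagonal q a n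
below-suc q a n with ℕ.<-cmp a n
... | tri< a<n a≢n _ = begin
  below q a (suc n)                   ≡⟨ ifᵈ-yes (a <? suc n) (ℕ.m<n⇒m<1+n a<n) ⟩
  q ^ a                               ≡⟨ sym (+-identityʳ (q ^ a)) ⟩
  q ^ a + + 0                         ≡⟨ sym (cong₂ _+_ (ifᵈ-yes (a <? n) a<n) (ifᵈ-no (a ≟ n) a≢n)) ⟩
  below q a n + diagonal q a n        ∎
  where open ≡-Reasoning
... | tri≈ a≮a refl _ = begin
  below q a (suc a)                   ≡⟨ ifᵈ-yes (a <? suc a) (ℕ.n<1+n a) ⟩
  q ^ a                               ≡⟨ sym (+-identityˡ (q ^ a)) ⟩
  + 0 + q ^ a                         ≡⟨ sym (cong₂ _+_ (ifᵈ-no (a <? a) a≮a) (ifᵈ-yes (a ≟ a) refl)) ⟩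
  below q a a + diagonal q a a        ∎
  where open ≡-Reasoning
... | tri> _ a≢n n<a = begin
  below q a (suc n)                   ≡⟨ ifᵈ-no (a <? suc n) (ℕ.<⇒≱ n<a ∘ ℕ.≤-pred) ⟩
  + 0                                 ≡⟨ sym (cong₂ _+_ (ifᵈ-no (a <? n) (ℕ.<⇒≯ n<a)) (ifᵈ-no (a ≟ n) a≢n)) ⟩
  below q a n + diagonal q a n        ∎
  where open ≡-Reasoning

sum-diagonal : ∀ q a n → ∑[ b < n ] diagonal q a b ≡ below q a n
sum-diagonal q a zero    = sym (ifᵈ-no (a <? 0) {q ^ a} λ ())
sum-diagonal q a (suc n) = begin
  ∑[ b < suc n ] diagonal q a b           ≡⟨ sumBelow-suc n (diagonal q a) ⟩
  ∑[ b < n ] diagonal q a b + diagonal q a n ≡⟨ cong (_+ diagonal q a n) (sum-diagonal q a n) ⟩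
  below q a n + diagonal q a n           ≡⟨ sym (below-suc q a n) ⟩
  below q a (suc n)                      ∎
  where open ≡-Reasoning

sum-below : ∀ q m n → ∑[ a < m ] below q a n ≡ ∑[ a < m ⊓ n ] q ^ a
sum-below q zero    n = refl
sum-below q (suc m) n with m <? n
... | yes m<n rewrite sumBelow-suc m (λ a → below q a n) | sum-below q m n
                    | ℕ.m≤n⇒m⊓n≡m (ℕ.<⇒≤ m<n) | ℕ.m≤n⇒m⊓n≡m m<n =
  trans (cong (_+_ (∑[ a < m ] q ^ a)) (ifᵈ-yes (m <? n) m<n)) (sym (sumBelow-suc m (q ^_)))
... | no  m≮n rewrite sumBelow-suc m (λ a → below q a n) | sum-below q m n
                    | ℕ.m≥n⇒m⊓n≡n (ℕ.≮⇒≥ m≮n) | ℕ.m≥n⇒m⊓n≡n (ℕ.m≤n⇒m≤1+n (ℕ.≮⇒≥ m≮n)) =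
  trans (cong (_+_ (∑[ a < n ] q ^ a)) (ifᵈ-no (m <? n) m≮n)) (+-identityʳ _)

pow-⊓-split : ∀ q m n → q ^ (m ⊓ n) ≡ diagonal q m n + below q n m + below q m n
pow-⊓-split q m n with ℕ.<-cmp m n
... | tri< m<n m≢n n≮m = begin
  q ^ (m ⊓ n)                                ≡⟨ cong (q ^_) (ℕ.m≤n⇒m⊓n≡m (ℕ.<⇒≤ m<n)) ⟩
  q ^ m                                      ≡⟨ sym (+-identityˡ (q ^ m)) ⟩
  + 0 + + 0 + q ^ m                          ≡⟨ sym (cong₂ _+_ (cong₂ _+_ (ifᵈ-no (m ≟ n) m≢n) (ifᵈ-no (n <? m) n≮m))
                                                               (ifᵈ-yes (m <? n) m<n)) ⟩
  diagonal q m n + below q n m + below q m n ∎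
  where open ≡-Reasoning
... | tri≈ m≮m refl _ = begin
  q ^ (m ⊓ m)                                ≡⟨ cong (q ^_) (ℕ.⊓-idem m) ⟩
  q ^ m                                      ≡⟨ sym (trans (+-identityʳ _) (+-identityʳ (q ^ m))) ⟩
  q ^ m + + 0 + + 0                          ≡⟨ sym (cong₂ _+_ (cong₂ _+_ (ifᵈ-yes (m ≟ m) refl) (ifᵈ-no (m <? m) m≮m))
                                                               (ifᵈ-no (m <? m) m≮m)) ⟩
  diagonal q m m + below q m m + below q m m ∎
  where open ≡-Reasoning
... | tri> m≮n m≢n n<m = begin
  q ^ (m ⊓ n)                                ≡⟨ cong (q ^_) (ℕ.m≥n⇒m⊓n≡n (ℕ.<⇒≤ n<m)) ⟩
  q ^ n                                      ≡⟨ sym (trans (+-identityʳ _) (+-identityˡ (q ^ n))) ⟩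
  + 0 + q ^ n + + 0                          ≡⟨ sym (cong₂ _+_ (cong₂ _+_ (ifᵈ-no (m ≟ n) m≢n) (ifᵈ-yes (n <? m) n<m))
                                                               (ifᵈ-no (m <? n) m≮n)) ⟩
  diagonal q m n + below q n m + below q m n ∎
  where open ≡-Reasoning

module _ (q : ℤ) {m n : ℕ} where

  weightℕ-strict : ∀ {a b} → a < m → b < n → weightℕ q a b m n ≡ q - + 1
  weightℕ-strict {a} {b} a<m b<n = trans (weightℕ-≤ q (ℕ.<⇒≤ a<m , ℕ.<⇒≤ b<n))
    (cong₂ (stepWeight q) (dec-false (a ≟ m) (ℕ.<⇒≢ a<m)) (dec-false (b ≟ n) (ℕ.<⇒≢ b<n)))

  weightℕ-sameRow : ∀ {b} → b < n → weightℕ q m b m n ≡ - + 1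
  weightℕ-sameRow {b} b<n = trans (weightℕ-≤ q (ℕ.≤-refl {m} , ℕ.<⇒≤ b<n))
    (cong₂ (stepWeight q) (dec-true (m ≟ m) refl) (dec-false (b ≟ n) (ℕ.<⇒≢ b<n)))

  weightℕ-sameCol : ∀ {a} → a < m → weightℕ q a n m n ≡ - + 1
  weightℕ-sameCol {a} a<m = trans (weightℕ-≤ q (ℕ.<⇒≤ a<m , ℕ.≤-refl {n}))
    (cong₂ (stepWeight q) (dec-false (a ≟ m) (ℕ.<⇒≢ a<m)) (dec-true (n ≟ n) refl))

  weightℕ-refl : weightℕ q m n m n ≡ + 0
  weightℕ-refl = trans (weightℕ-≤ q (ℕ.≤-refl {m} , ℕ.≤-refl {n}))
    (cong₂ (stepWeight q) (dec-true (m ≟ m) refl) (dec-true (n ≟ n) refl))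

  row-sum : ∀ {a} → a < m →
    ∑[ b < suc n ] (weightℕ q a b m n * diagonal q a b) ≡ (q - + 1) * below q a n + - + 1 * diagonal q a n
  row-sum {a} a<m = begin
    ∑[ b < suc n ] (weightℕ q a b m n * diagonal q a b)
      ≡⟨ sumBelow-suc n _ ⟩
    ∑[ b < n ] (weightℕ q a b m n * diagonal q a b) + weightℕ q a n m n * diagonal q a n
      ≡⟨ cong₂ _+_ (sumBelow-cong n (λ b b<n → cong (_* diagonal q a b) (weightℕ-strict a<m b<n)))
                   (cong (_* diagonal q a n) (weightℕ-sameCol a<m)) ⟩
    ∑[ b < n ] ((q - + 1) * diagonal q a b) + - + 1 * diagonal q a n
      ≡⟨ cong (_+ - + 1 * diagonal q a n)
              (trans (sumBelow-*ˡ n (q - + 1) (diagonal q a)) (cong ((q - + 1) *_) (sum-diagonal q a n))) ⟩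
    (q - + 1) * below q a n + - + 1 * diagonal q a n
      ∎
    where open ≡-Reasoning

  last-row-sum : ∑[ b < suc n ] (weightℕ q m b m n * diagonal q m b) ≡ - + 1 * below q m n
  last-row-sum = begin
    ∑[ b < suc n ] (weightℕ q m b m n * diagonal q m b)
      ≡⟨ sumBelow-suc n _ ⟩
    ∑[ b < n ] (weightℕ q m b m n * diagonal q m b) + weightℕ q m n m n * diagonal q m n
      ≡⟨ cong₂ _+_ (sumBelow-cong n (λ b b<n → cong (_* diagonal q m b) (weightℕ-sameRow b<n)))
                   (trans (cong (_* diagonal q m n) weightℕ-refl) (*-zeroˡ (diagonal q m n))) ⟩
    ∑[ b < n ] (- + 1 * diagonal q m b) + + 0
      ≡⟨ +-identityʳ _ ⟩
    ∑[ b < n ] (- + 1 * diagonal q m b)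
      ≡⟨ trans (sumBelow-*ˡ n (- + 1) (diagonal q m)) (cong (- + 1 *_) (sum-diagonal q m n)) ⟩
    - + 1 * below q m n
      ∎
    where open ≡-Reasoning

  sum-weightℕ-truncate : ∀ {M N} → m < M → n < N →
    ∑[ a < M ] ∑[ b < N ] (weightℕ q a b m n * diagonal q a b)
      ≡ ∑[ a < suc m ] ∑[ b < suc n ] (weightℕ q a b m n * diagonal q a b)
  sum-weightℕ-truncate {M} {N} m<M n<N =
    trans (sumBelow-vanishing (λ a → ∑[ b < N ] (weightℕ q a b m n * diagonal q a b)) m<M (λ a m<a →
             trans (sumBelow-cong N (λ b _ → vanish {a} {b} (λ (a≤m , _) → ℕ.<⇒≱ m<a a≤m))) (sumBelow-zero N)))
          (sumBelow-cong (suc m) (λ a _ →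
             sumBelow-vanishing (λ b → weightℕ q a b m n * diagonal q a b) n<N
               (λ b n<b → vanish {a} (λ (_ , b≤n) → ℕ.<⇒≱ n<b b≤n))))
    where
    vanish : ∀ {a b} → ¬ (a ≤ m × b ≤ n) → weightℕ q a b m n * diagonal q a b ≡ + 0
    vanish {a} {b} outside = trans (cong (_* diagonal q a b) (weightℕ-≰ q outside)) (*-zeroˡ (diagonal q a b))

  corner-identity : ∑[ a < suc m ] ∑[ b < suc n ] (weightℕ q a b m n * diagonal q a b) ≡ diagonal q m n - + 1
  corner-identity = begin
    ∑[ a < suc m ] ∑[ b < suc n ] (weightℕ q a b m n * diagonal q a b)
      ≡⟨ sumBelow-suc m _ ⟩
    ∑[ a < m ] ∑[ b < suc n ] (weightℕ q a b m n * diagonal q a b) + ∑[ b < suc n ] (weightℕ q m b m n * diagonal q m b)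
      ≡⟨ cong₂ _+_ (sumBelow-cong m (λ a → row-sum)) last-row-sum ⟩
    ∑[ a < m ] ((q - + 1) * below q a n + - + 1 * diagonal q a n) + - + 1 * below q m n
      ≡⟨ cong (_+ - + 1 * below q m n) (sumBelow-+ m _ _) ⟩
    ∑[ a < m ] ((q - + 1) * below q a n) + ∑[ a < m ] (- + 1 * diagonal q a n) + - + 1 * below q m n
      ≡⟨ cong (_+ - + 1 * below q m n) (cong₂ _+_
           (trans (sumBelow-*ˡ m (q - + 1) (λ a → below q a n)) (cong ((q - + 1) *_) (sum-below q m n)))
           (trans (sumBelow-*ˡ m (- + 1) (λ a → diagonal q a n))
                  (cong (- + 1 *_) (trans (sumBelow-cong m (λ a _ → diagonal-comm q a n)) (sum-diagonal q n m))))) ⟩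
    (q - + 1) * (∑[ a < m ⊓ n ] q ^ a) + - + 1 * below q n m + - + 1 * below q m n
      ≡⟨ cong (λ x → x + - + 1 * below q n m + - + 1 * below q m n) (geometric-sum q (m ⊓ n)) ⟩
    q ^ (m ⊓ n) - + 1 + - + 1 * below q n m + - + 1 * below q m n
      ≡⟨ cong (λ x → x - + 1 + - + 1 * below q n m + - + 1 * below q m n) (pow-⊓-split q m n) ⟩
    diagonal q m n + below q n m + below q m n - + 1 + - + 1 * below q n m + - + 1 * below q m n
      ≡⟨ cancel (diagonal q m n) (below q n m) (below q m n) ⟩
    diagonal q m n - + 1
      ∎
    where
    open ≡-Reasoning
    cancel : ∀ d x y → d + x + y - + 1 + - + 1 * x + - + 1 * y ≡ d - + 1
    cancel = solve-∀

≤∸-swap : ∀ {R i a} → a ≤ R → i ≤ R ∸ a → a ≤ R ∸ i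
≤∸-swap {R} {i} a≤R i≤R∸a = subst (_≤ R ∸ i) (ℕ.m∸[m∸n]≡n a≤R) (ℕ.∸-monoʳ-≤ R i≤R∸a)

≡∸-swap : ∀ {R i a} → a ≤ R → i ≡ R ∸ a → a ≡ R ∸ i
≡∸-swap a≤R refl = sym (ℕ.m∸[m∸n]≡n a≤R)

weightℕ-reverse : ∀ q {R S i j a b} → i ≤ R → j ≤ S → a ≤ R → b ≤ S →
  weightℕ q i j (R ∸ a) (S ∸ b) ≡ weightℕ q a b (R ∸ i) (S ∸ j)
weightℕ-reverse q {R} {S} {i} {j} {a} {b} i≤R j≤S a≤R b≤S =
  cong₂ (λ inside repeated → if inside then stepWeight q (proj₁ repeated) (proj₂ repeated) else + 0)
    (cong₂ _∧_ (does-⇔ (mk⇔ (≤∸-swap a≤R) (≤∸-swap i≤R)) (i ≤? R ∸ a) (a ≤? R ∸ i))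
               (does-⇔ (mk⇔ (≤∸-swap b≤S) (≤∸-swap j≤S)) (j ≤? S ∸ b) (b ≤? S ∸ j)))
    (cong₂ _,_ (does-⇔ (mk⇔ (≡∸-swap a≤R) (≡∸-swap i≤R)) (i ≟ R ∸ a) (a ≟ R ∸ i))
               (does-⇔ (mk⇔ (≡∸-swap b≤S) (≡∸-swap j≤S)) (j ≟ S ∸ b) (b ≟ S ∸ j)))

cornerValue : ∀ {r s} → ℤ → Pos r s → ℤ
cornerValue {r} {s} q (i , j) = diagonal q (r ∸ suc (toℕ i)) (s ∸ suc (toℕ j))

sum-weight-cornerValue : ∀ {r s} q (p : Pos r s) →
  sumOver (λ p' → weight q p p' * cornerValue q p') (allPos r s) ≡ cornerValue q p - + 1
sum-weight-cornerValue {suc R} {suc S} q (i , j) = begin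
  sumOver (λ p' → weight q (i , j) p' * cornerValue q p') (allPos (suc R) (suc S))
    ≡⟨ sumOver-allPos (suc R) (suc S) _ F (λ _ _ → refl) ⟩
  ∑[ i' < suc R ] ∑[ j' < suc S ] F i' j'
    ≡⟨ sym (sumBelow-reverse₂ (suc R) (suc S) F) ⟩
  ∑[ a < suc R ] ∑[ b < suc S ] F (R ∸ a) (S ∸ b)
    ≡⟨ sumBelow-cong (suc R) (λ a a<1+R → sumBelow-cong (suc S) (λ b b<1+S → F-reversed (ℕ.≤-pred a<1+R) (ℕ.≤-pred b<1+S))) ⟩
  ∑[ a < suc R ] ∑[ b < suc S ] (weightℕ q a b m n * diagonal q a b)
    ≡⟨ sum-weightℕ-truncate q (s≤s (ℕ.m∸n≤m R (toℕ i))) (s≤s (ℕ.m∸n≤m S (toℕ j))) ⟩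
  ∑[ a < suc m ] ∑[ b < suc n ] (weightℕ q a b m n * diagonal q a b)
    ≡⟨ corner-identity q {m} {n} ⟩
  diagonal q m n - + 1
    ∎
  where
  open ≡-Reasoning
  m = R ∸ toℕ i
  n = S ∸ toℕ j
  F : ℕ → ℕ → ℤ
  F i' j' = weightℕ q (toℕ i) (toℕ j) i' j' * diagonal q (R ∸ i') (S ∸ j')
  F-reversed : ∀ {a b} → a ≤ R → b ≤ S → F (R ∸ a) (S ∸ b) ≡ weightℕ q a b m n * diagonal q a b
  F-reversed a≤R b≤S = cong₂ _*_
    (weightℕ-reverse q (ℕ.≤-pred (toℕ<n i)) (ℕ.≤-pred (toℕ<n j)) a≤R b≤S)
    (cong₂ (diagonal q) (ℕ.m∸[m∸n]≡n a≤R) (ℕ.m∸[m∸n]≡n b≤S))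

r+s≤1+r*s : ∀ {r s} → 1 ≤ r → 1 ≤ s → r ℕ.+ s ≤ suc (r ℕ.* s)
r+s≤1+r*s {suc r'} {suc s'} _ _ = s≤s (begin
  r' ℕ.+ suc s'          ≡⟨ ℕ.+-comm r' (suc s') ⟩
  suc s' ℕ.+ r'          ≤⟨ ℕ.+-monoʳ-≤ (suc s') (ℕ.m≤m*n r' (suc s')) ⟩
  suc s' ℕ.+ r' ℕ.* suc s' ∎)
  where open ℕ.≤-Reasoning

module _ (r s : ℕ) (q : ℤ) where

  private
    Ps : List (Pos r s)
    Ps = allPos r s

  weightFrom : ℕ → Pos r s → ℤ
  weightFrom k p = sumOver (λ L → cellWeight q (p ∷ L)) (listsOfLength k Ps)

  weightFromBelow : ℕ → Pos r s → ℤ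
  weightFromBelow N p = ∑[ k < N ] weightFrom k p

  weightFrom-zero : ∀ p → weightFrom 0 p ≡ q - + 1
  weightFrom-zero p = singleton (q - + 1)
    where
    singleton : ∀ x → (x * + 1) * + 1 + + 0 ≡ x
    singleton = solve-∀

  weightFrom-suc : ∀ k p → weightFrom (suc k) p ≡ sumOver (λ p' → weight q p p' * weightFrom k p') Ps
  weightFrom-suc k p = begin
    weightFrom (suc k) p
      ≡⟨ sumOver-concatMap (λ L → cellWeight q (p ∷ L)) (λ p' → map (p' ∷_) (listsOfLength k Ps)) Ps ⟩
    sumOver (λ p' → sumOver (λ L → cellWeight q (p ∷ L)) (map (p' ∷_) (listsOfLength k Ps))) Ps
      ≡⟨ sumOver-cong Ps (λ p' → sumOver-map (λ L → cellWeight q (p ∷ L)) (p' ∷_) (listsOfLength k Ps)) ⟩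
    sumOver (λ p' → sumOver (λ L → cellWeight q (p ∷ p' ∷ L)) (listsOfLength k Ps)) Ps
      ≡⟨ sumOver-cong Ps (λ p' → sumOver-cong (listsOfLength k Ps) (cellWeight-∷∷ q p p')) ⟩
    sumOver (λ p' → sumOver (λ L → weight q p p' * cellWeight q (p' ∷ L)) (listsOfLength k Ps)) Ps
      ≡⟨ sumOver-cong Ps (λ p' → sumOver-*ˡ (weight q p p') (λ L → cellWeight q (p' ∷ L)) (listsOfLength k Ps)) ⟩
    sumOver (λ p' → weight q p p' * weightFrom k p') Ps
      ∎
    where open ≡-Reasoning

  weightFromBelow-suc : ∀ N p →
    weightFromBelow (suc N) p ≡ (q - + 1) + sumOver (λ p' → weight q p p' * weightFromBelow N p') Ps
  weightFromBelow-suc N p = cong₂ _+_ (weightFrom-zero p) (begin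
    ∑[ k < N ] weightFrom (suc k) p
      ≡⟨ sumBelow-cong N (λ k _ → weightFrom-suc k p) ⟩
    ∑[ k < N ] sumOver (λ p' → weight q p p' * weightFrom k p') Ps
      ≡⟨ sumBelow-sumOver-comm N (λ k p' → weight q p p' * weightFrom k p') Ps ⟩
    sumOver (λ p' → ∑[ k < N ] (weight q p p' * weightFrom k p')) Ps
      ≡⟨ sumOver-cong Ps (λ p' → sumBelow-*ˡ N (weight q p p') (λ k → weightFrom k p')) ⟩
    sumOver (λ p' → weight q p p' * weightFromBelow N p') Ps
      ∎)
    where open ≡-Reasoning

  cellSum-by-first-position : cellSum r s q ≡ + 1 + sumOver (weightFromBelow (r ℕ.* s)) Ps
  cellSum-by-first-position = begin
    cellSum r s q
      ≡⟨ sumOver-filter isCell? (term q) (listsUpTo (r ℕ.* s) Ps) ⟩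
    sumOver (cellWeight q) (listsUpTo (r ℕ.* s) Ps)
      ≡⟨ sumOver-concatMap (cellWeight q) (λ k → listsOfLength k Ps) (upTo (suc (r ℕ.* s))) ⟩
    sumOver (λ k → sumOver (cellWeight q) (listsOfLength k Ps)) (upTo (suc (r ℕ.* s)))
      ≡⟨ sumOver-applyUpTo (λ k → sumOver (cellWeight q) (listsOfLength k Ps)) id (suc (r ℕ.* s)) ⟩
    + 1 + ∑[ k < r ℕ.* s ] sumOver (cellWeight q) (listsOfLength (suc k) Ps)
      ≡⟨ cong (_+_ (+ 1)) (sumBelow-cong (r ℕ.* s) (λ k _ →
           trans (sumOver-concatMap (cellWeight q) (λ p → map (p ∷_) (listsOfLength k Ps)) Ps)
                 (sumOver-cong Ps (λ p → sumOver-map (cellWeight q) (p ∷_) (listsOfLength k Ps))))) ⟩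
    + 1 + ∑[ k < r ℕ.* s ] sumOver (weightFrom k) Ps
      ≡⟨ cong (_+_ (+ 1)) (sumBelow-sumOver-comm (r ℕ.* s) weightFrom Ps) ⟩
    + 1 + sumOver (weightFromBelow (r ℕ.* s)) Ps
      ∎
    where open ≡-Reasoning

  depth : Pos r s → ℕ
  depth (i , j) = (r ∸ toℕ i) ℕ.+ (s ∸ toℕ j)

  depth-< : ∀ {p p'} → p ≼ p' → p ≢ p' → depth p' < depth p
  depth-< {i , j} {i' , j'} (i≤i' , j≤j') p≢p' with toℕ i ≟ toℕ i'
  ... | no  i≢i' = ℕ.+-mono-<-≤ (ℕ.∸-monoʳ-< (ℕ.≤∧≢⇒< i≤i' i≢i') (ℕ.<⇒≤ (toℕ<n i'))) (ℕ.∸-monoʳ-≤ s j≤j')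
  ... | yes i≡i' = ℕ.+-mono-≤-< (ℕ.∸-monoʳ-≤ r i≤i') (ℕ.∸-monoʳ-< (ℕ.≤∧≢⇒< j≤j' j≢j') (ℕ.<⇒≤ (toℕ<n j')))
    where
    j≢j' : toℕ j ≢ toℕ j'
    j≢j' j≡j' = p≢p' (cong₂ _,_ (toℕ-injective i≡i') (toℕ-injective j≡j'))

  -- A cell starting at p has fewer than depth p entries, so truncating at length N loses nothing.
  weightFromBelow-stable : ∀ N p → depth p ≤ suc N → weightFromBelow N p ≡ (q - + 1) * cornerValue q p
  weightFromBelow-stable zero (i , j) depth≤1 =
    contradiction depth≤1 (ℕ.<⇒≱ (ℕ.+-mono-≤ (ℕ.m<n⇒0<n∸m (toℕ<n i)) (ℕ.m<n⇒0<n∸m (toℕ<n j))))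
  weightFromBelow-stable (suc N) p depth≤2+N = begin
    weightFromBelow (suc N) p
      ≡⟨ weightFromBelow-suc N p ⟩
    (q - + 1) + sumOver (λ p' → weight q p p' * weightFromBelow N p') Ps
      ≡⟨ cong (_+_ (q - + 1)) (sumOver-cong Ps stable) ⟩
    (q - + 1) + sumOver (λ p' → (q - + 1) * (weight q p p' * cornerValue q p')) Ps
      ≡⟨ cong (_+_ (q - + 1)) (sumOver-*ˡ (q - + 1) (λ p' → weight q p p' * cornerValue q p') Ps) ⟩
    (q - + 1) + (q - + 1) * sumOver (λ p' → weight q p p' * cornerValue q p') Ps
      ≡⟨ cong (λ x → (q - + 1) + (q - + 1) * x) (sum-weight-cornerValue q p) ⟩
    (q - + 1) + (q - + 1) * (cornerValue q p - + 1)
      ≡⟨ collect (q - + 1) (cornerValue q p) ⟩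
    (q - + 1) * cornerValue q p
      ∎
    where
    open ≡-Reasoning
    collect : ∀ a x → a + a * (x - + 1) ≡ a * x
    collect = solve-∀
    stable : ∀ p' → weight q p p' * weightFromBelow N p' ≡ (q - + 1) * (weight q p p' * cornerValue q p')
    stable p' with weight-support q p p'
    ... | inj₁ w≡0 rewrite w≡0 = trans (*-zeroˡ (weightFromBelow N p'))
      (sym (trans (cong ((q - + 1) *_) (*-zeroˡ (cornerValue q p'))) (*-zeroʳ (q - + 1))))
    ... | inj₂ (p≼p' , p≢p') rewrite weightFromBelow-stable N p' (ℕ.≤-pred (ℕ.<-≤-trans (depth-< p≼p' p≢p') depth≤2+N)) =
      swap (q - + 1) (weight q p p') (cornerValue q p')
      where
      swap : ∀ a w x → w * (a * x) ≡ a * (w * x)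
      swap = solve-∀

  sum-cornerValue : sumOver (cornerValue q) Ps ≡ ∑[ k < r ⊓ s ] q ^ k
  sum-cornerValue = begin
    sumOver (cornerValue q) Ps
      ≡⟨ sumOver-allPos r s (cornerValue q) (λ i j → diagonal q (r ∸ suc i) (s ∸ suc j)) (λ _ _ → refl) ⟩
    ∑[ i < r ] ∑[ j < s ] diagonal q (r ∸ suc i) (s ∸ suc j)
      ≡⟨ sumBelow-reverse₂ r s (diagonal q) ⟩
    ∑[ a < r ] ∑[ b < s ] diagonal q a b
      ≡⟨ sumBelow-cong r (λ a _ → sum-diagonal q a s) ⟩
    ∑[ a < r ] below q a s
      ≡⟨ sum-below q r s ⟩
    ∑[ k < r ⊓ s ] q ^ k
      ∎
    where open ≡-Reasoning

proposition5p6 : (r s : ℕ) → 1 ≤ r → 1 ≤ s →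
    (q : ℤ) → cellSum r s q ≡ q ^ (r ⊓ s)
proposition5p6 r s 1≤r 1≤s q = begin
  cellSum r s q                                                   ≡⟨ cellSum-by-first-position r s q ⟩
  + 1 + sumOver (weightFromBelow r s q (r ℕ.* s)) (allPos r s)    ≡⟨ cong (_+_ (+ 1)) (sumOver-cong (allPos r s) stable) ⟩
  + 1 + sumOver (λ p → (q - + 1) * cornerValue q p) (allPos r s)  ≡⟨ cong (_+_ (+ 1)) (sumOver-*ˡ (q - + 1) (cornerValue q) (allPos r s)) ⟩
  + 1 + (q - + 1) * sumOver (cornerValue q) (allPos r s)          ≡⟨ cong (λ x → + 1 + (q - + 1) * x) (sum-cornerValue r s q) ⟩
  + 1 + (q - + 1) * (∑[ k < r ⊓ s ] q ^ k)                        ≡⟨ cong (_+_ (+ 1)) (geometric-sum q (r ⊓ s)) ⟩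
  + 1 + (q ^ (r ⊓ s) - + 1)                                       ≡⟨ cancel (q ^ (r ⊓ s)) ⟩
  q ^ (r ⊓ s)                                                     ∎
  where
  open ≡-Reasoning
  cancel : ∀ x → + 1 + (x - + 1) ≡ x
  cancel = solve-∀
  stable : ∀ p → weightFromBelow r s q (r ℕ.* s) p ≡ (q - + 1) * cornerValue q p
  stable p@(i , j) = weightFromBelow-stable r s q (r ℕ.* s) p
    (ℕ.≤-trans (ℕ.+-mono-≤ (ℕ.m∸n≤m r (toℕ i)) (ℕ.m∸n≤m s (toℕ j))) (r+s≤1+r*s 1≤r 1≤s))
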